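{- Let $C$ be a self-dual $L$-code of length $n\geq 1$ with minimal Euclidean weight $d$. Then $d\leq n+1$. If moreover $C$ is even, then $d\leq 2\lfloor n/3\rfloor+2$.
   Context: Let $L=\{0,1,\omega,\bar\omega\}$ be the Klein four-group $\mathbf{Z}_2\times\mathbf{Z}_2$. Define $|0|^2=0$, $|1|^2=1$, $|\omega|^2=|\bar\omega|^2=2$; the dot product $x\cdot y\in\mathbf{F}_2$ is $1$ iff $x,y$ are distinct and nonzero. On $L^n$: $(\mathbf{x},\mathbf{y})=\sum_i x_i\cdot y_i$, $\mathrm{ewt}(\mathbf{x})=\sum_i|x_i|^2$. An $L$-code is a subgroup $C\subseteq L^n$; it is self-dual if $C=\{\mathbf{z}:(\mathbf{z},\mathbf{y})=0\ \forall\mathbf{y}\in C\}$ and even if all codewords have even Euclidean weight. The minimal Euclidean weight is $\min\{\mathrm{ewt}(\mathbf{x}):\mathbf{x}\in C\setminus\{0\}\}$. -}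

module Defs where

open import Data.Nat using (ℕ; zero; suc; _+_)
open import Data.Bool using (Bool; true; false; _xor_)
open import Data.Fin using (Fin)
open import Data.Product using (_×_; Σ; _,_)
open import Relation.Binary.PropositionalEquality using (_≡_)
open import Relation.Nullary using (¬_)
open import Data.Vec.Functional using (Vector; foldr)

data L : Set where
  l0 l1 lω lω̄ : L

_⊕_ : L → L → L
l0 ⊕ y = y
x ⊕ l0 = x
l1 ⊕ l1 = l0
l1 ⊕ lω = lω̄
l1 ⊕ lω̄ = lω
lω ⊕ l1 = lω̄
lω ⊕ lω = l0
lω ⊕ lω̄ = l1
lω̄ ⊕ l1 = lω
lω̄ ⊕ lω = l1
lω̄ ⊕ lω̄ = l0

norm : L → ℕ
norm l0 = 0
norm l1 = 1
norm lω = 2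
norm lω̄ = 2

dot : L → L → Bool
dot l1 lω = true
dot l1 lω̄ = true
dot lω l1 = true
dot lω lω̄ = true
dot lω̄ l1 = true
dot lω̄ lω = true
dot _ _ = false

Word : ℕ → Set
Word n = Vector L n

zeroW : ∀ {n} → Word n
zeroW _ = l0

_⊕W_ : ∀ {n} → Word n → Word n → Word n
(x ⊕W y) i = x i ⊕ y i

inner : ∀ {n} → Word n → Word n → Bool
inner x y = foldr _xor_ false (λ i → dot (x i) (y i))

ewt : ∀ {n} → Word n → ℕ
ewt x = foldr _+_ 0 (λ i → norm (x i))

IsNonzero : ∀ {n} → Word n → Set
IsNonzero x = ¬ (∀ i → x i ≡ l0)

-- An L-code: a subgroup of L^n, given as a predicate on words
-- (in an elementary abelian 2-group, closure under 0 and ⊕ is exactly being a subgroup).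
record IsLCode {n : ℕ} (C : Word n → Set) : Set where
  field
    has-zero : C zeroW
    closed-⊕ : ∀ {x y} → C x → C y → C (x ⊕W y)
    resp : ∀ {x y} → (∀ i → x i ≡ y i) → C x → C y

IsSelfDual : ∀ {n} → (Word n → Set) → Set
IsSelfDual {n} C = ∀ (z : Word n) →
  (C z → ∀ y → C y → inner z y ≡ false) × ((∀ y → C y → inner z y ≡ false) → C z)

IsEven : ∀ {n} → (Word n → Set) → Set
IsEven {n} C = ∀ (x : Word n) → C x → Σ ℕ (λ k → ewt x ≡ k + k)

IsMinEwt : ∀ {n} → (Word n → Set) → ℕ → Set
IsMinEwt {n} C d =
  Σ (Word n) (λ x → C x × IsNonzero x × ewt x ≡ d)
  × (∀ (x : Word n) → C x → IsNonzero x → d Data.Nat.≤ ewt x)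

-- Both bounds follow from one fact: C contains nonzero words x, y with
-- x ⊕ y ≠ 0 and ewt x + ewt y + ewt (x ⊕ y) ≤ 2n + 6; since each of the
-- three has weight ≥ d, this gives 3d ≤ 2n + 6.
--
-- The form (_,_) makes Lⁿ a symplectic F₂-space and C satisfies C^⊥ ⊆ C
-- ("coisotropic").  Shortening a coisotropic code along its first
-- coordinate — keep the codewords whose first entry lies in {0,1} and
-- delete that entry — yields a coisotropic code of length n − 1.  Shortening
-- n − 2 times reaches length 2, where a coisotropic code is too large to lie
-- inside {0, p} for any p, so it contains a "plane" {0, x, y, x ⊕ y}; that
-- plane has total weight ≤ 10, and lifting it back adds at most 2 per
-- deleted coordinate, because entries from {0,1} are light.
--
-- Membership in a code is not decidable, so the dual inclusion of a
-- shortened code, and everything downstream of it, holds up to double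
-- negation; this is harmless because the final inequalities are decidable.
module Submission where

open import Defs
open import Data.Nat using (ℕ; suc; _≤_; _+_; _*_; _/_)
open import Data.Product using (_×_)

open import Algebra using (CommutativeRing)
open import Data.Bool using (Bool; true; false; _xor_; _∧_)
open import Data.Bool.Properties
  using (xor-∧-commutativeRing; xor-same; ∧-zeroʳ; ∧-identityʳ)
  renaming (_≟_ to _≟ᵇ_)
open import Data.Empty using (⊥; ⊥-elim)
open import Data.Fin using () renaming (zero to fzero; suc to fsuc)
open import Data.Fin.Properties using (all?)
open import Data.Nat using (zero; _∸_; z≤n; s≤s; _≤?_)
open import Data.Nat.DivMod using (m*n/n≡m; /-monoˡ-≤; m/n≡1+[m∸n]/n)
open import Data.Nat.Properties
open import Data.Nat.Tactic.RingSolver using (solve-∀)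
open import Data.Product using (Σ; ∃; _,_; proj₂)
open import Data.Sum using (_⊎_; inj₁; inj₂; [_,_]′)
open import Data.Vec.Functional using (_∷_; []; tail)
open import Function using (_∘_)
open import Relation.Binary.PropositionalEquality
  using (_≡_; refl; sym; trans; cong; cong₂; subst; subst₂; module ≡-Reasoning)
open import Relation.Nullary using (¬_; Dec; yes; no)
open import Relation.Nullary.Decidable
  using (map′; _×-dec_; ¬?; from-yes; decidable-stable)
open import Relation.Nullary.Negation using (¬¬-map; ¬¬-Monad)
open import Effect.Monad using (RawMonad)
open import Level using (0ℓ)
open import Relation.Nullary.Decidable.Core using (¬¬-excluded-middle)
open import Relation.Unary using (Decidable)

open RawMonad (¬¬-Monad {0ℓ}) using (_>>=_)

open import Algebra.Properties.CommutativeSemigroup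
  (CommutativeRing.+-commutativeSemigroup xor-∧-commutativeRing)
  using (interchange)

-- Quantifying over the four elements of L is decidable, so identities
-- about L can be verified by evaluation.
every? : {P : L → Set} → Decidable P → Dec (∀ a → P a)
every? P? = map′ (λ (p₀ , p₁ , pω , pω̄) → λ { l0 → p₀ ; l1 → p₁ ; lω → pω ; lω̄ → pω̄ })
                 (λ p → p l0 , p l1 , p lω , p lω̄)
                 (P? l0 ×-dec P? l1 ×-dec P? lω ×-dec P? lω̄)

some? : {P : L → Set} → Decidable P → Dec (∃ P)
some? P? with P? l0 | P? l1 | P? lω | P? lω̄
... | yes p | _     | _     | _     = yes (l0 , p)
... | no _  | yes p | _     | _     = yes (l1 , p)
... | no _  | no _  | yes p | _     = yes (lω , p)
... | no _  | no _  | no _  | yes p = yes (lω̄ , p)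
... | no ¬p₀ | no ¬p₁ | no ¬pω | no ¬pω̄ =
  no λ { (l0 , p) → ¬p₀ p ; (l1 , p) → ¬p₁ p ; (lω , p) → ¬pω p ; (lω̄ , p) → ¬pω̄ p }

is-l0? : (a : L) → Dec (a ≡ l0)
is-l0? l0 = yes refl
is-l0? l1 = no λ ()
is-l0? lω = no λ ()
is-l0? lω̄ = no λ ()

dot-linear : ∀ a b c → dot a (b ⊕ c) ≡ dot a b xor dot a c
dot-linear = from-yes (every? λ a → every? λ b → every? λ c →
  dot a (b ⊕ c) ≟ᵇ (dot a b xor dot a c))

dot-zeroʳ : ∀ a → dot a l0 ≡ false
dot-zeroʳ = from-yes (every? λ a → dot a l0 ≟ᵇ false)

norm≤2 : ∀ a → norm a ≤ 2
norm≤2 = from-yes (every? λ a → norm a ≤? 2)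

pair-norm≤5 : ∀ a b → norm a + norm b + norm (a ⊕ b) ≤ 5
pair-norm≤5 = from-yes (every? λ a → every? λ b → norm a + norm b + norm (a ⊕ b) ≤? 5)

-- For every p = (a, b) ∈ L² some z = (c, e) ∉ {0, p} is orthogonal to p:
-- p^⊥ has 8 elements.
escape : ∀ a b → Σ L λ c → Σ L λ e →
  ¬ (c ≡ l0 × e ≡ l0) × ¬ (a ⊕ c ≡ l0 × b ⊕ e ≡ l0) × dot c a xor (dot e b xor false) ≡ false
escape = from-yes (every? λ a → every? λ b → some? λ c → some? λ e →
  ¬? (is-l0? c ×-dec is-l0? e) ×-dec ¬? (is-l0? (a ⊕ c) ×-dec is-l0? (b ⊕ e))
  ×-dec (dot c a xor (dot e b xor false) ≟ᵇ false))

-- The light subgroup {0, 1} of L: the kernel of the functional a ↦ 1 · a.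
bit : Bool → L
bit false = l0
bit true = l1

bit-⊕ : ∀ s t → bit s ⊕ bit t ≡ bit (s xor t)
bit-⊕ false t = refl
bit-⊕ true false = refl
bit-⊕ true true = refl

bit-pair-norm≤2 : ∀ s t → norm (bit s) + norm (bit t) + norm (bit s ⊕ bit t) ≤ 2
bit-pair-norm≤2 false false = z≤n
bit-pair-norm≤2 false true = s≤s (s≤s z≤n)
bit-pair-norm≤2 true false = s≤s (s≤s z≤n)
bit-pair-norm≤2 true true = s≤s (s≤s z≤n)

dot-bit : ∀ s a → dot (bit s) a ≡ s ∧ dot l1 a
dot-bit false a = refl
dot-bit true a = refl

light : ∀ a → dot l1 a ≡ false → Σ Bool λ s → a ≡ bit s
light l0 _ = false , refl
light l1 _ = true , refl

IsZeroWord : ∀ {n} → Word n → Set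
IsZeroWord x = ∀ i → x i ≡ l0

zero-word? : ∀ {n} (x : Word n) → Dec (IsZeroWord x)
zero-word? x = all? (λ i → is-l0? (x i))

head∷tail : ∀ {n} (x : Word (suc n)) → ∀ i → (x fzero ∷ tail x) i ≡ x i
head∷tail x fzero = refl
head∷tail x (fsuc i) = refl

inner-linear : ∀ {n} (z y v : Word n) → inner z (y ⊕W v) ≡ inner z y xor inner z v
inner-linear {zero} z y v = refl
inner-linear {suc n} z y v = trans
  (cong₂ _xor_ (dot-linear (z fzero) (y fzero) (v fzero)) (inner-linear (tail z) (tail y) (tail v)))
  (interchange (dot (z fzero) (y fzero)) (dot (z fzero) (v fzero)) (inner (tail z) (tail y)) (inner (tail z) (tail v)))

inner-zeroʳ : ∀ {n} (z y : Word n) → IsZeroWord y → inner z y ≡ false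
inner-zeroʳ {zero} z y _ = refl
inner-zeroʳ {suc n} z y y≡0 = cong₂ _xor_
  (trans (cong (dot (z fzero)) (y≡0 fzero)) (dot-zeroʳ (z fzero)))
  (inner-zeroʳ (tail z) (tail y) (y≡0 ∘ fsuc))

weight3 : ∀ {n} → Word n → Word n → ℕ
weight3 x y = ewt x + ewt y + ewt (x ⊕W y)

weight3-cons : ∀ {n} (x y : Word (suc n)) → weight3 x y ≡
  (norm (x fzero) + norm (y fzero) + norm (x fzero ⊕ y fzero)) + weight3 (tail x) (tail y)
weight3-cons x y = interchange₃ (norm (x fzero)) (norm (y fzero)) (norm (x fzero ⊕ y fzero))
  (ewt (tail x)) (ewt (tail y)) (ewt (tail x ⊕W tail y))
  where
    interchange₃ : ∀ a b c u v w → (a + u) + (b + v) + (c + w) ≡ (a + b + c) + (u + v + w)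
    interchange₃ = solve-∀

-- Coordinatewise bound from pair-norm≤5; for n = 2 it gives the base weight 10.
weight3≤5n : ∀ {n} (x y : Word n) → weight3 x y ≤ 5 * n
weight3≤5n {zero} x y = z≤n
weight3≤5n {suc n} x y = begin
  weight3 x y                                   ≡⟨ weight3-cons x y ⟩
  (norm (x fzero) + norm (y fzero) + norm (x fzero ⊕ y fzero)) + weight3 (tail x) (tail y)
      ≤⟨ +-mono-≤ (pair-norm≤5 (x fzero) (y fzero)) (weight3≤5n (tail x) (tail y)) ⟩
  5 + 5 * n                                     ≡⟨ *-suc 5 n ⟨
  5 * suc n                                     ∎
  where open ≤-Reasoning

_⟂_ : ∀ {n} → Word n → (Word n → Set) → Set
z ⟂ D = ∀ y → D y → inner z y ≡ false

record IsCoisotropic {n : ℕ} (D : Word n → Set) : Set where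
  field
    closed : ∀ {x y} → D x → D y → D (x ⊕W y)
    resp : ∀ {x y} → (∀ i → x i ≡ y i) → D x → D y
    dual⊆ : ∀ z → z ⟂ D → ¬ ¬ D z

self-dual⇒coisotropic : ∀ {n} {C : Word n → Set} → IsLCode C → IsSelfDual C → IsCoisotropic C
self-dual⇒coisotropic code sd = record
  { closed = IsLCode.closed-⊕ code
  ; resp = IsLCode.resp code
  ; dual⊆ = λ z z⟂C ¬z∈C → ¬z∈C (proj₂ (sd z) z⟂C)
  }

shorten : ∀ {n} → (Word (suc n) → Set) → Word n → Set
shorten D w = Σ Bool λ s → D (bit s ∷ w)

module Shortening {n : ℕ} {D : Word (suc n) → Set} (cD : IsCoisotropic D) where
  open IsCoisotropic cD

  tail-shortens : ∀ {y} → D y → dot l1 (y fzero) ≡ false → shorten D (tail y)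
  tail-shortens {y} y∈D light-head with light (y fzero) light-head
  ... | s , y₀≡s = s , resp (λ i → trans (sym (head∷tail y i)) (cong (λ a → (a ∷ tail y) i) y₀≡s)) y∈D

  closed-shorten : ∀ {p q} → shorten D p → shorten D q → shorten D (p ⊕W q)
  closed-shorten {p} {q} (s , p∈) (t , q∈) = s xor t , resp cons-⊕ (closed p∈ q∈)
    where
      cons-⊕ : ∀ i → ((bit s ∷ p) ⊕W (bit t ∷ q)) i ≡ (bit (s xor t) ∷ (p ⊕W q)) i
      cons-⊕ fzero = bit-⊕ s t
      cons-⊕ (fsuc i) = refl

  resp-shorten : ∀ {p q} → (∀ i → p i ≡ q i) → shorten D p → shorten D q
  resp-shorten {p} {q} p≡q (s , p∈) = s , resp cons-≡ p∈
    where
      cons-≡ : ∀ i → (bit s ∷ p) i ≡ (bit s ∷ q) i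
      cons-≡ fzero = refl
      cons-≡ (fsuc i) = p≡q i

  -- s is the value of y ↦ (z, tail y) on all heavy codewords y, i.e. those
  -- whose first entry is ω or ω̄ (1 · y₀ = 1).
  ValueOnHeavy : Word n → Bool → Set
  ValueOnHeavy z s = ∀ y → D y → dot l1 (y fzero) ≡ true → inner z (tail y) ≡ s

  extend-orthogonal : ∀ {z} → z ⟂ shorten D → ∀ s → ValueOnHeavy z s → (bit s ∷ z) ⟂ D
  extend-orthogonal {z} z⟂ s value y y∈D = begin
    inner (bit s ∷ z) y                           ≡⟨ cong (_xor inner z (tail y)) (dot-bit s (y fzero)) ⟩
    (s ∧ dot l1 (y fzero)) xor inner z (tail y)   ≡⟨ by-head (dot l1 (y fzero)) refl ⟩
    false                                         ∎
    where
      open ≡-Reasoning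
      by-head : ∀ b → dot l1 (y fzero) ≡ b → (s ∧ b) xor inner z (tail y) ≡ false
      by-head false light-head = cong₂ _xor_ (∧-zeroʳ s) (z⟂ (tail y) (tail-shortens y∈D light-head))
      by-head true heavy-head = trans (cong₂ _xor_ (∧-identityʳ s) (value y y∈D heavy-head)) (xor-same s)

  -- A linear functional vanishing on the light codewords is constant on the
  -- heavy ones: y ⊕ y₁ is light whenever y and y₁ are heavy.
  constant-on-heavy : ∀ {z} → z ⟂ shorten D → ∀ {y₁} → D y₁ → dot l1 (y₁ fzero) ≡ true →
    ValueOnHeavy z (inner z (tail y₁))
  constant-on-heavy {z} z⟂ {y₁} y₁∈D heavy₁ y y∈D heavy = xor≡false (begin
    inner z (tail y) xor inner z (tail y₁)     ≡⟨ inner-linear z (tail y) (tail y₁) ⟨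
    inner z (tail (y ⊕W y₁))                   ≡⟨ z⟂ _ (tail-shortens (closed y∈D y₁∈D) light-sum) ⟩
    false                                      ∎)
    where
      open ≡-Reasoning
      light-sum : dot l1 (y fzero ⊕ y₁ fzero) ≡ false
      light-sum = trans (dot-linear l1 (y fzero) (y₁ fzero)) (cong₂ _xor_ heavy heavy₁)
      xor≡false : ∀ {a b} → a xor b ≡ false → a ≡ b
      xor≡false {false} {false} _ = refl
      xor≡false {true} {true} _ = refl

  -- If D has a heavy codeword y₁, the value (z, tail y₁) makes the
  -- extension orthogonal; otherwise the value false does, vacuously.
  dual⊆-shorten : ∀ z → z ⟂ shorten D → ¬ ¬ shorten D z
  dual⊆-shorten z z⟂ = ¬¬-excluded-middle >>= choose
    where
      Heavy : Set
      Heavy = Σ (Word (suc n)) λ y → D y × dot l1 (y fzero) ≡ true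
      choose : Dec Heavy → ¬ ¬ shorten D z
      choose (no none) = ¬¬-map (false ,_)
        (dual⊆ _ (extend-orthogonal z⟂ false λ y y∈D heavy → ⊥-elim (none (y , y∈D , heavy))))
      choose (yes (y₁ , y₁∈D , heavy₁)) = ¬¬-map (inner z (tail y₁) ,_)
        (dual⊆ _ (extend-orthogonal z⟂ _ (constant-on-heavy z⟂ y₁∈D heavy₁)))

  shorten-coisotropic : IsCoisotropic (shorten D)
  shorten-coisotropic = record { closed = closed-shorten ; resp = resp-shorten ; dual⊆ = dual⊆-shorten }

record Plane {n : ℕ} (D : Word n → Set) (k : ℕ) : Set where
  constructor plane
  field
    {x y} : Word n
    x∈D : D x
    y∈D : D y
    x≢0 : IsNonzero x
    y≢0 : IsNonzero y
    x⊕y≢0 : IsNonzero (x ⊕W y)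
    weight≤ : weight3 x y ≤ k

lift-plane : ∀ {n k} {D : Word (suc n) → Set} → Plane (shorten D) k → Plane D (2 + k)
lift-plane {k = k} (plane {p} {q} (s , p∈D) (t , q∈D) p≢0 q≢0 p⊕q≢0 weight≤) =
  plane p∈D q∈D (λ x≡0 → p≢0 (x≡0 ∘ fsuc)) (λ y≡0 → q≢0 (y≡0 ∘ fsuc))
    (λ x⊕y≡0 → p⊕q≢0 (x⊕y≡0 ∘ fsuc)) (begin
      weight3 (bit s ∷ p) (bit t ∷ q)
        ≡⟨ weight3-cons (bit s ∷ p) (bit t ∷ q) ⟩
      (norm (bit s) + norm (bit t) + norm (bit s ⊕ bit t)) + weight3 p q
        ≤⟨ +-mono-≤ (bit-pair-norm≤2 s t) weight≤ ⟩
      2 + k ∎)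
  where open ≤-Reasoning

⟂-along-zero-sum : ∀ {n} (z p y : Word n) → inner z p ≡ false → IsZeroWord (p ⊕W y) → inner z y ≡ false
⟂-along-zero-sum z p y z⟂p p⊕y≡0 = begin
  inner z y                    ≡⟨ cong (_xor inner z y) z⟂p ⟨
  inner z p xor inner z y      ≡⟨ inner-linear z p y ⟨
  inner z (p ⊕W y)             ≡⟨ inner-zeroʳ z (p ⊕W y) p⊕y≡0 ⟩
  false                        ∎
  where open ≡-Reasoning

one-is-zero : ∀ {n} (y w : Word n) → ¬ (IsNonzero y × IsNonzero w) → IsZeroWord y ⊎ IsZeroWord w
one-is-zero y w not-both with zero-word? y
... | yes y≡0 = inj₁ y≡0
... | no y≢0 = inj₂ (decidable-stable (zero-word? w) λ w≢0 → not-both (y≢0 , w≢0))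

module LengthTwo {D : Word 2 → Set} (cD : IsCoisotropic D) where
  open IsCoisotropic cD

  -- A coisotropic code in L² has at least 4 elements, so lies in no {0, p}.
  not-within-pair : ∀ p → (∀ y → D y → IsZeroWord y ⊎ IsZeroWord (p ⊕W y)) → ⊥
  not-within-pair p within with escape (p fzero) (p (fsuc fzero))
  ... | c , e , z≢0 , p⊕z≢0 , z⟂p = dual⊆ z z⟂D z∉D
    where
      z : Word 2
      z = c ∷ e ∷ []
      z⟂D : z ⟂ D
      z⟂D y y∈D = [ inner-zeroʳ z y , ⟂-along-zero-sum z p y z⟂p ]′ (within y y∈D)
      z∉D : ¬ D z
      z∉D z∈D = [ (λ z≡0 → z≢0 (z≡0 fzero , z≡0 (fsuc fzero)))
                , (λ p⊕z≡0 → p⊕z≢0 (p⊕z≡0 fzero , p⊕z≡0 (fsuc fzero))) ]′ (within z z∈D)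

  -- Not inside {0, 0} gives a nonzero p ∈ D; not inside {0, p} gives q.
  plane-in-length-two : ¬ ¬ Plane D 10
  plane-in-length-two = ¬¬-excluded-middle >>= first
    where
      first : Dec (Σ (Word 2) λ p → D p × IsNonzero p) → ¬ ¬ Plane D 10
      first (no none) _ = not-within-pair zeroW λ y y∈D →
        inj₁ (decidable-stable (zero-word? y) λ y≢0 → none (y , y∈D , y≢0))
      first (yes (p , p∈D , p≢0)) = ¬¬-excluded-middle >>= second
        where
          second : Dec (Σ (Word 2) λ q → D q × IsNonzero q × IsNonzero (p ⊕W q)) → ¬ ¬ Plane D 10
          second (no none) _ = not-within-pair p λ y y∈D →
            one-is-zero y (p ⊕W y) λ (y≢0 , p⊕y≢0) → none (y , y∈D , y≢0 , p⊕y≢0)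
          second (yes (q , q∈D , q≢0 , p⊕q≢0)) found =
            found (plane p∈D q∈D p≢0 q≢0 p⊕q≢0 (weight3≤5n p q))

plane-exists : ∀ m {D : Word (2 + m) → Set} → IsCoisotropic D → ¬ ¬ Plane D (2 * (2 + m) + 6)
plane-exists zero cD = LengthTwo.plane-in-length-two cD
plane-exists (suc m) cD =
  ¬¬-map (subst (Plane _) (budget m) ∘ lift-plane) (plane-exists m (Shortening.shorten-coisotropic cD))
  where
    budget : ∀ m → 2 + (2 * (2 + m) + 6) ≡ 2 * (2 + suc m) + 6
    budget = solve-∀

plane-bounds-min-weight : ∀ {n d k} {C : Word n → Set} → IsLCode C → IsMinEwt C d →
  Plane C k → d + d + d ≤ k
plane-bounds-min-weight code (_ , minimal) (plane x∈C y∈C x≢0 y≢0 x⊕y≢0 weight≤) = ≤-trans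
  (+-mono-≤ (+-mono-≤ (minimal _ x∈C x≢0) (minimal _ y∈C y≢0))
            (minimal _ (IsLCode.closed-⊕ code x∈C y∈C) x⊕y≢0))
  weight≤

third-bound : ∀ n d → 1 ≤ n → d + d + d ≤ 2 * n + 6 → d ≤ n + 1
third-bound n d 1≤n 3d≤ = ≤-pred (*-cancelʳ-< 3 d (suc (n + 1)) (begin-strict
  d * 3             ≡⟨ triple d ⟩
  d + d + d         ≤⟨ 3d≤ ⟩
  2 * n + 6         <⟨ m<m+n (2 * n + 6) 1≤n ⟩
  2 * n + 6 + n     ≡⟨ regroup n ⟩
  suc (n + 1) * 3   ∎))
  where
    open ≤-Reasoning
    triple : ∀ d → d * 3 ≡ d + d + d
    triple = solve-∀
    regroup : ∀ n → 2 * n + 6 + n ≡ suc (n + 1) * 3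
    regroup = solve-∀

third-floor : ∀ n e → e * 3 ≤ n + 3 → e ≤ n / 3 + 1
third-floor n e 3e≤ = begin
  e                     ≡⟨ m*n/n≡m e 3 ⟨
  e * 3 / 3             ≤⟨ /-monoˡ-≤ 3 3e≤ ⟩
  (n + 3) / 3           ≡⟨ m/n≡1+[m∸n]/n (m≤n+m 3 n) ⟩
  1 + (n + 3 ∸ 3) / 3   ≡⟨ cong (λ m → 1 + m / 3) (m+n∸n≡m n 3) ⟩
  1 + n / 3             ≡⟨ +-comm 1 (n / 3) ⟩
  n / 3 + 1             ∎
  where open ≤-Reasoning

even-third-bound : ∀ n e → (e + e) + (e + e) + (e + e) ≤ 2 * n + 6 → e + e ≤ 2 * (n / 3) + 2
even-third-bound n e 6e≤ = begin
  e + e                       ≤⟨ +-mono-≤ e≤ e≤ ⟩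
  (n / 3 + 1) + (n / 3 + 1)   ≡⟨ double (n / 3) ⟩
  2 * (n / 3) + 2             ∎
  where
    open ≤-Reasoning
    six : ∀ e → 2 * (e * 3) ≡ (e + e) + (e + e) + (e + e)
    six = solve-∀
    halve : ∀ n → 2 * n + 6 ≡ 2 * (n + 3)
    halve = solve-∀
    double : ∀ q → (q + 1) + (q + 1) ≡ 2 * q + 2
    double = solve-∀
    e≤ : e ≤ n / 3 + 1
    e≤ = third-floor n e (*-cancelˡ-≤ 2 (subst₂ _≤_ (sym (six e)) (halve n) 6e≤))

-- Length 1 is immediate since every word weighs at most 2; for length
-- 2 + m, a plane of weight ≤ 2n + 6 gives 3d ≤ 2n + 6.
lemma4p13 : ∀ (n : ℕ) → 1 ≤ n → (C : Word n → Set) → IsLCode C → IsSelfDual C →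
    (d : ℕ) → IsMinEwt C d →
    (d ≤ n + 1) × (IsEven C → d ≤ 2 * (n / 3) + 2)
lemma4p13 (suc zero) _ C _ _ d ((x , _ , _ , refl) , _) = length-one , λ _ → length-one
  where
    length-one : ewt x ≤ 2
    length-one = subst (_≤ 2) (sym (+-identityʳ (norm (x fzero)))) (norm≤2 (x fzero))
lemma4p13 n@(suc (suc m)) 1≤n C code sd d min-weight@((x , x∈C , _ , ewt≡d) , _) =
  decidable-stable (d ≤? n + 1) (¬¬-map (third-bound n d 1≤n) 3d≤) , even-case
  where
    3d≤ : ¬ ¬ (d + d + d ≤ 2 * n + 6)
    3d≤ = ¬¬-map (plane-bounds-min-weight code min-weight)
                 (plane-exists m (self-dual⇒coisotropic code sd))
    even-case : IsEven C → d ≤ 2 * (n / 3) + 2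
    even-case even with even x x∈C
    ... | e , ewt≡2e with trans (sym ewt≡d) ewt≡2e
    ... | refl = decidable-stable (_ ≤? _) (¬¬-map (even-third-bound n e) 3d≤)
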